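{- Let $\mathbb{F}_q$ be a finite field with $q > 5$ odd, and let $c_1,\dots,c_6 \in \mathbb{F}_q$ satisfy $c_1c_4 - c_2c_3 \neq 0$, $c_1c_6 - c_2c_5 \neq 0$ and $c_3c_6 - c_4c_5 \neq 0$. Then for all $\delta_1,\delta_2,\delta_3 \in \mathbb{F}_q^\ast$ and all $\lambda_1,\lambda_2,\lambda_3 \in \mathbb{F}_q$ there exist $u,v \in \mathbb{F}_q$ and $s_1,s_2,s_3 \in \mathbb{F}_q^\ast$ such that $$c_1u + c_2v = \delta_1 s_1^2 + \lambda_1,\quad c_3u + c_4v = \delta_2 s_2^2 + \lambda_2,\quad c_5u + c_6v = \delta_3 s_3^2 + \lambda_3.$$ -}

module Defs where

open import Level using (_⊔_)
open import Algebra.Bundles using (CommutativeRing)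
open import Data.Nat using (ℕ)
open import Data.Fin using (Fin)
open import Data.Product using (∃)
open import Relation.Nullary using (¬_)
open import Relation.Binary.PropositionalEquality using (_≡_)

record IsFiniteField {c ℓ} (R : CommutativeRing c ℓ) (q : ℕ) : Set (c ⊔ ℓ) where
  open CommutativeRing R
  field
    0≉1             : ¬ (0# ≈ 1#)
    inverse         : ∀ x → ¬ (x ≈ 0#) → ∃ λ y → x * y ≈ 1#
    enum            : Fin q → Carrier
    enum-injective  : ∀ i j → enum i ≈ enum j → i ≡ j
    enum-surjective : ∀ x → ∃ λ i → enum i ≈ x

{-# OPTIONS --safe #-}
module Submission where

open import Defs
open import Algebra.Bundles using (CommutativeRing)
open import Data.Nat using (ℕ; _<_; _%_)
open import Data.Product using (Σ; _×_)
open import Relation.Nullary using (¬_)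
open import Relation.Binary.PropositionalEquality using (_≡_)

import Algebra.Solver.Ring.AlmostCommutativeRing as ACR
open import Data.Bool using (Bool; true; false; not)
open import Data.Bool.Properties using (not-injective)
open import Data.Empty using (⊥-elim)
open import Data.Fin as Fin using (Fin; zero; suc; _≤?_)
open import Data.Fin.Patterns using (0F; 1F; 2F; 3F; 4F)
open import Data.Fin.Properties
  using (any?; all?; <⇒notInjective; *↔×; 2↔Bool; ≤-antisym; ≤-total; ≤-reflexive)
open import Data.Integer as ℤ using (ℤ; +_; -[1+_]; _⊖_; sign; ∣_∣; _◃_)
import Data.Integer.Properties as ℤ
open import Data.Maybe using (Maybe; just; nothing)
open import Data.Nat as ℕ using (zero; suc)
open import Data.Nat.Properties using (+-suc; n<1+n)
open import Data.Product using (_,_; ∃; ∃₂; proj₁; proj₂)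
open import Data.Product.Function.NonDependent.Propositional using (_×-↔_)
open import Data.Product.Properties using (×-≡,≡←≡)
open import Data.Sign as Sign using (Sign)
open import Data.Sum using (_⊎_; inj₁; inj₂; [_,_]′)
open import Data.Vec using (_∷_; []; lookup)
open import Function using (_∘_; _↔_; Inverse; Injection; Injective)
open import Function.Construct.Composition using (_↔-∘_)
open import Function.Construct.Identity using (↔-id)
open import Function.Properties.Inverse using (↔⇒↣; ↔-sym)
open import Level using (_⊔_)
import Relation.Binary.PropositionalEquality as ≡
open ≡ using (_≢_)
open import Relation.Binary.Definitions using (Decidable)
open import Relation.Nullary using (Dec; yes; no; does; ¬?)
open import Relation.Nullary.Decidable using (dec-true; map′)

-- Eliminating u and v by Cramer's rule (c₁c₄ − c₂c₃ ≠ 0) leaves the single condition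
-- A s₁² + B s₂² = C s₃² + K with A, B, C ≠ 0. Choose s₃ ≠ 0 with t = C s₃² + K ≠ 0; it remains to
-- write t = A s₁² + B s₂² with s₁, s₂ ≠ 0. Squaring is at most two-to-one and one-to-one at 0, so
-- the values A x² and the values t − B y² each form a set of more than q/2 elements, and the two
-- sets meet. If the resulting solution has a zero coordinate, the rational parametrisation of the
-- conic through it gives a solution off the axes; q > 5 leaves room to avoid the few bad
-- parameters. In characteristic 2 every element is a square, so s₂ can be chosen first and s₁
-- solved for.

missing-point⇒¬injective : ∀ {a} {X : Set a} {n} → Fin n ↔ X → (f : X → X) (p : X) →
                           (∀ x → f x ≢ p) → ¬ Injective _≡_ _≡_ f
missing-point⇒¬injective {n = n} Fin↔X f p f≢p f-injective = <⇒notInjective (n<1+n n) g-injective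
  where
  open Inverse Fin↔X using (to; from)
  to-injective : Injective _≡_ _≡_ to
  to-injective = Injection.injective (↔⇒↣ Fin↔X)
  from-injective : Injective _≡_ _≡_ from
  from-injective = Injection.injective (↔⇒↣ (↔-sym Fin↔X))
  g : Fin (suc n) → Fin n
  g zero    = from p
  g (suc k) = from (f (to k))
  g-injective : Injective _≡_ _≡_ g
  g-injective {zero}  {zero}   _  = ≡.refl
  g-injective {zero}  {suc k}  eq = ⊥-elim (f≢p (to k) (≡.sym (from-injective eq)))
  g-injective {suc k} {zero}   eq = ⊥-elim (f≢p (to k) (from-injective eq))
  g-injective {suc k} {suc k′} eq = ≡.cong suc (to-injective (f-injective (from-injective eq)))

Fin[2*n]↔Bool×Fin : ∀ n → Fin (2 ℕ.* n) ↔ (Bool × Fin n)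
Fin[2*n]↔Bool×Fin n = (2↔Bool ×-↔ ↔-id (Fin n)) ↔-∘ *↔× {2} {n}

from-dec-true : ∀ {p} {P : Set p} (p? : Dec P) → does p? ≡ true → P
from-dec-true (yes p) _ = p

≤?-symmetric⇒≡ : ∀ {n} (i j : Fin n) → does (i ≤? j) ≡ does (j ≤? i) → i ≡ j
≤?-symmetric⇒≡ i j same with ≤-total i j
... | inj₁ i≤j = ≤-antisym i≤j (from-dec-true (j ≤? i) (≡.trans (≡.sym same) (dec-true (i ≤? j) i≤j)))
... | inj₂ j≤i = ≤-antisym (from-dec-true (i ≤? j) (≡.trans same (dec-true (j ≤? i) j≤i))) j≤i

-- With integer coefficients the ring solver can cancel terms such as x - x, which it cannot do
-- when the coefficients are abstract elements of R itself (as in Tactic.RingSolver).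
module IntegerCoefficientSolver {c ℓ} (R : CommutativeRing c ℓ) where
  open CommutativeRing R
  open import Algebra.Properties.Ring ring using (-‿involutive; -0#≈0#; -1*x≈-x; -‿+-comm)
  open import Algebra.Properties.Semiring.Mult semiring using (×-homo-+; ×1-homo-*)
    renaming (_×_ to _×′_)
  open import Algebra.Properties.CommutativeSemigroup +-commutativeSemigroup using ()
    renaming (interchange to +-interchange)
  open import Algebra.Properties.CommutativeSemigroup *-commutativeSemigroup using ()
    renaming (interchange to *-interchange)
  open import Relation.Binary.Reasoning.Setoid setoid

  fromℤ : ℤ → Carrier
  fromℤ (+ n)    = n ×′ 1#
  fromℤ -[1+ n ] = - (suc n ×′ 1#)

  fromℤ-⊖ : ∀ m n → fromℤ (m ⊖ n) ≈ m ×′ 1# - n ×′ 1#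
  fromℤ-⊖ zero    zero    = sym (-‿inverseʳ 0#)
  fromℤ-⊖ (suc m) zero    = sym (trans (+-congˡ -0#≈0#) (+-identityʳ _))
  fromℤ-⊖ zero    (suc n) = sym (+-identityˡ _)
  fromℤ-⊖ (suc m) (suc n) = begin
    fromℤ (suc m ⊖ suc n)             ≡⟨ ≡.cong fromℤ (ℤ.[1+m]⊖[1+n]≡m⊖n m n) ⟩
    fromℤ (m ⊖ n)                     ≈⟨ fromℤ-⊖ m n ⟩
    a - b                             ≈⟨ +-identityˡ (a - b) ⟨
    0# + (a - b)                      ≈⟨ +-congʳ (-‿inverseʳ 1#) ⟨
    (1# - 1#) + (a - b)               ≈⟨ +-interchange 1# (- 1#) a (- b) ⟩
    (1# + a) + (- 1# + - b)           ≈⟨ +-congˡ (-‿+-comm 1# b) ⟩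
    (1# + a) - (1# + b)               ∎
    where
    a = m ×′ 1#
    b = n ×′ 1#

  fromℤ-+ : ∀ i j → fromℤ (i ℤ.+ j) ≈ fromℤ i + fromℤ j
  fromℤ-+ (+ m)    (+ n)    = ×-homo-+ 1# m n
  fromℤ-+ (+ m)    -[1+ n ] = fromℤ-⊖ m (suc n)
  fromℤ-+ -[1+ m ] (+ n)    = trans (fromℤ-⊖ n (suc m)) (+-comm _ _)
  fromℤ-+ -[1+ m ] -[1+ n ] = begin
    - (suc (suc (m ℕ.+ n)) ×′ 1#)      ≡⟨ ≡.cong (λ k → - (suc k ×′ 1#)) (+-suc m n) ⟨
    - ((suc m ℕ.+ suc n) ×′ 1#)        ≈⟨ -‿cong (×-homo-+ 1# (suc m) (suc n)) ⟩
    - (suc m ×′ 1# + suc n ×′ 1#)      ≈⟨ -‿+-comm _ _ ⟨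
    - (suc m ×′ 1#) + - (suc n ×′ 1#)  ∎

  fromℤ-neg : ∀ i → fromℤ (ℤ.- i) ≈ - fromℤ i
  fromℤ-neg (+ zero)  = sym -0#≈0#
  fromℤ-neg (+ suc n) = refl
  fromℤ-neg -[1+ n ]  = sym (-‿involutive _)

  fromSign : Sign → Carrier
  fromSign Sign.+ = 1#
  fromSign Sign.- = - 1#

  fromSign-* : ∀ s t → fromSign (s Sign.* t) ≈ fromSign s * fromSign t
  fromSign-* Sign.+ _      = sym (*-identityˡ _)
  fromSign-* Sign.- Sign.+ = sym (*-identityʳ _)
  fromSign-* Sign.- Sign.- = sym (trans (-1*x≈-x _) (-‿involutive _))

  fromℤ-◃ : ∀ s n → fromℤ (s ◃ n) ≈ fromSign s * (n ×′ 1#)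
  fromℤ-◃ s      zero    = sym (zeroʳ _)
  fromℤ-◃ Sign.+ (suc n) = sym (*-identityˡ _)
  fromℤ-◃ Sign.- (suc n) = sym (-1*x≈-x _)

  fromℤ-sign-abs : ∀ i → fromℤ i ≈ fromSign (sign i) * (∣ i ∣ ×′ 1#)
  fromℤ-sign-abs i = trans (reflexive (≡.cong fromℤ (≡.sym (ℤ.◃-inverse i)))) (fromℤ-◃ (sign i) ∣ i ∣)

  fromℤ-* : ∀ i j → fromℤ (i ℤ.* j) ≈ fromℤ i * fromℤ j
  fromℤ-* i j = begin
    fromℤ ((sign i Sign.* sign j) ◃ (∣ i ∣ ℕ.* ∣ j ∣))
      ≈⟨ fromℤ-◃ (sign i Sign.* sign j) (∣ i ∣ ℕ.* ∣ j ∣) ⟩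
    fromSign (sign i Sign.* sign j) * ((∣ i ∣ ℕ.* ∣ j ∣) ×′ 1#)
      ≈⟨ *-cong (fromSign-* (sign i) (sign j)) (×1-homo-* ∣ i ∣ ∣ j ∣) ⟩
    (fromSign (sign i) * fromSign (sign j)) * ((∣ i ∣ ×′ 1#) * (∣ j ∣ ×′ 1#))
      ≈⟨ *-interchange _ _ _ _ ⟩
    (fromSign (sign i) * (∣ i ∣ ×′ 1#)) * (fromSign (sign j) * (∣ j ∣ ×′ 1#))
      ≈⟨ *-cong (fromℤ-sign-abs i) (fromℤ-sign-abs j) ⟨
    fromℤ i * fromℤ j ∎

  fromℤ-homomorphism : ℤ.+-*-rawRing ACR.-Raw-AlmostCommutative⟶ ACR.fromCommutativeRing R
  fromℤ-homomorphism = record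
    { ⟦_⟧    = fromℤ
    ; +-homo = fromℤ-+
    ; *-homo = fromℤ-*
    ; -‿homo = fromℤ-neg
    ; 0-homo = refl
    ; 1-homo = +-identityʳ 1#
    }

  fromℤ-≟ : ∀ i j → Maybe (fromℤ i ≈ fromℤ j)
  fromℤ-≟ i j with i ℤ.≟ j
  ... | yes ≡.refl = just refl
  ... | no _     = nothing

  open import Algebra.Solver.Ring ℤ.+-*-rawRing (ACR.fromCommutativeRing R) fromℤ-homomorphism fromℤ-≟
    public

module CommutativeRingLemmas {c ℓ} (R : CommutativeRing c ℓ) where
  open CommutativeRing R
  open IntegerCoefficientSolver R using (solve; _:+_; _:*_; _:-_; :-_; _:=_)
  open import Algebra.Properties.Ring ring
    using (-‿injective; -0#≈0#; +-inverseˡ-unique; x∙y⁻¹≈ε⇒x≈y; x≈y⇒x∙y⁻¹≈ε)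
  open import Relation.Binary.Reasoning.Setoid setoid

  x+x≈[1+1]*x : ∀ x → x + x ≈ (1# + 1#) * x
  x+x≈[1+1]*x x = sym (trans (distribʳ x 1# 1#) (+-cong (*-identityˡ x) (*-identityˡ x)))

  -x≈0⇒x≈0 : ∀ {x} → - x ≈ 0# → x ≈ 0#
  -x≈0⇒x≈0 -x≈0 = -‿injective (trans -x≈0 (sym -0#≈0#))

  x≈0⇒y*[x*x]≈0 : ∀ {x} y → x ≈ 0# → y * (x * x) ≈ 0#
  x≈0⇒y*[x*x]≈0 {x} y x≈0 = trans (*-congˡ (trans (*-congʳ x≈0) (zeroˡ x))) (zeroʳ y)

  x*y≈1⇒x*[y*z]≈z : ∀ {x y} → x * y ≈ 1# → ∀ z → x * (y * z) ≈ z
  x*y≈1⇒x*[y*z]≈z {x} {y} xy≈1 z = trans (sym (*-assoc x y z)) (trans (*-congʳ xy≈1) (*-identityˡ z))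

  x*x≈y*y⇒[y-x]*[y+x]≈0 : ∀ {x y} → x * x ≈ y * y → (y - x) * (y + x) ≈ 0#
  x*x≈y*y⇒[y-x]*[y+x]≈0 {x} {y} x²≈y² =
    trans (solve 2 (λ x y → (y :- x) :* (y :+ x) := y :* y :- x :* x) refl x y) (x≈y⇒x∙y⁻¹≈ε (sym x²≈y²))

  -- (x, y) is the second intersection of the conic A x² + B y² = A x₀² with the line of slope
  -- A / (B m) through its point (- x₀, 0).
  conic-parametrisation : ∀ A B x₀ m d → (B * (m * m) + A) * d ≈ 1# →
    let x = x₀ * (B * (m * m) - A) * d
        y = (x₀ + x₀) * A * m * d
    in A * (x * x) + B * (y * y) ≈ A * (x₀ * x₀)
  conic-parametrisation A B x₀ m d Dd≈1 = begin
    A * (x * x) + B * (y * y)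
      ≈⟨ solve 5 (λ A B x₀ m d →
           A :* ((x₀ :* (B :* (m :* m) :- A) :* d) :* (x₀ :* (B :* (m :* m) :- A) :* d))
             :+ B :* (((x₀ :+ x₀) :* A :* m :* d) :* ((x₀ :+ x₀) :* A :* m :* d))
           := A :* (x₀ :* x₀) :* ((B :* (m :* m) :+ A) :* d) :* ((B :* (m :* m) :+ A) :* d))
           refl A B x₀ m d ⟩
    A * (x₀ * x₀) * ((B * (m * m) + A) * d) * ((B * (m * m) + A) * d)
      ≈⟨ *-cong (*-congˡ Dd≈1) Dd≈1 ⟩
    A * (x₀ * x₀) * 1# * 1#
      ≈⟨ trans (*-identityʳ _) (*-identityʳ _) ⟩
    A * (x₀ * x₀) ∎
    where
    x = x₀ * (B * (m * m) - A) * d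
    y = (x₀ + x₀) * A * m * d

  module DiscreteField (0≉1 : 0# ≉ 1#) (inverse : ∀ x → x ≉ 0# → ∃ λ y → x * y ≈ 1#)
                       (_≟_ : Decidable _≈_) where
    x*y≈1⇒y≉0 : ∀ {x y} → x * y ≈ 1# → y ≉ 0#
    x*y≈1⇒y≉0 {x} xy≈1 y≈0 = 0≉1 (trans (sym (zeroʳ x)) (trans (*-congˡ (sym y≈0)) xy≈1))

    *-cancelˡ : ∀ {x y z} → x ≉ 0# → x * y ≈ x * z → y ≈ z
    *-cancelˡ {x} {y} {z} x≉0 xy≈xz with inverse x x≉0
    ... | x⁻¹ , xx⁻¹≈1 = trans (sym (undo y)) (trans (*-congˡ xy≈xz) (undo z))
      where
      undo : ∀ w → x⁻¹ * (x * w) ≈ w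
      undo = x*y≈1⇒x*[y*z]≈z (trans (*-comm x⁻¹ x) xx⁻¹≈1)

    x*y≈0⇒x≈0⊎y≈0 : ∀ {x y} → x * y ≈ 0# → x ≈ 0# ⊎ y ≈ 0#
    x*y≈0⇒x≈0⊎y≈0 {x} {y} xy≈0 with x ≟ 0#
    ... | yes x≈0 = inj₁ x≈0
    ... | no  x≉0 = inj₂ (*-cancelˡ x≉0 (trans xy≈0 (sym (zeroʳ x))))

    *-≉0 : ∀ {x y} → x ≉ 0# → y ≉ 0# → x * y ≉ 0#
    *-≉0 x≉0 y≉0 xy≈0 = [ x≉0 , y≉0 ]′ (x*y≈0⇒x≈0⊎y≈0 xy≈0)

    -‿≉0 : ∀ {x} → x ≉ 0# → - x ≉ 0#
    -‿≉0 x≉0 = x≉0 ∘ -x≈0⇒x≈0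

    x+x≉0 : 1# + 1# ≉ 0# → ∀ {x} → x ≉ 0# → x + x ≉ 0#
    x+x≉0 1+1≉0 {x} x≉0 x+x≈0 = *-≉0 1+1≉0 x≉0 (trans (sym (x+x≈[1+1]*x x)) x+x≈0)

    x*x≈y*y⇒y≈x⊎y≈-x : ∀ {x y} → x * x ≈ y * y → y ≈ x ⊎ y ≈ - x
    x*x≈y*y⇒y≈x⊎y≈-x {x} {y} x²≈y² with x*y≈0⇒x≈0⊎y≈0 (x*x≈y*y⇒[y-x]*[y+x]≈0 x²≈y²)
    ... | inj₁ y-x≈0 = inj₁ (x∙y⁻¹≈ε⇒x≈y y x y-x≈0)
    ... | inj₂ y+x≈0 = inj₂ (+-inverseˡ-unique y x y+x≈0)

  module Elimination (c₁ c₂ c₃ c₄ c₅ c₆ δ₁ δ₂ δ₃ λ₁ λ₂ λ₃ : Carrier) where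
    D₁₂ D₁₆ D₃₆ : Carrier
    D₁₂ = c₁ * c₄ - c₂ * c₃
    D₁₆ = c₁ * c₆ - c₂ * c₅
    D₃₆ = c₃ * c₆ - c₄ * c₅

    A B C K : Carrier
    A = - D₃₆ * δ₁
    B = D₁₆ * δ₂
    C = D₁₂ * δ₃
    K = D₁₂ * λ₃ + D₃₆ * λ₁ - D₁₆ * λ₂

    cramer : ∀ {e} w₁ w₂ w₃ → D₁₂ * e ≈ 1# → D₁₆ * w₂ - D₃₆ * w₁ ≈ D₁₂ * w₃ →
             ∃₂ λ u v → c₁ * u + c₂ * v ≈ w₁ × c₃ * u + c₄ * v ≈ w₂ × c₅ * u + c₆ * v ≈ w₃
    cramer {e} w₁ w₂ w₃ D₁₂e≈1 compatible = u , v , eq₁ , eq₂ , eq₃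
      where
      u = (c₄ * w₁ - c₂ * w₂) * e
      v = (c₁ * w₂ - c₃ * w₁) * e
      D₁₂e*w≈w : ∀ w → (D₁₂ * e) * w ≈ w
      D₁₂e*w≈w w = trans (*-congʳ D₁₂e≈1) (*-identityˡ w)
      eq₁ : c₁ * u + c₂ * v ≈ w₁
      eq₁ = trans (solve 7 (λ c₁ c₂ c₃ c₄ w₁ w₂ e →
              c₁ :* ((c₄ :* w₁ :- c₂ :* w₂) :* e) :+ c₂ :* ((c₁ :* w₂ :- c₃ :* w₁) :* e)
              := ((c₁ :* c₄ :- c₂ :* c₃) :* e) :* w₁) refl c₁ c₂ c₃ c₄ w₁ w₂ e) (D₁₂e*w≈w w₁)
      eq₂ : c₃ * u + c₄ * v ≈ w₂
      eq₂ = trans (solve 7 (λ c₁ c₂ c₃ c₄ w₁ w₂ e →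
              c₃ :* ((c₄ :* w₁ :- c₂ :* w₂) :* e) :+ c₄ :* ((c₁ :* w₂ :- c₃ :* w₁) :* e)
              := ((c₁ :* c₄ :- c₂ :* c₃) :* e) :* w₂) refl c₁ c₂ c₃ c₄ w₁ w₂ e) (D₁₂e*w≈w w₂)
      eq₃ : c₅ * u + c₆ * v ≈ w₃
      eq₃ = begin
        c₅ * u + c₆ * v
          ≈⟨ solve 9 (λ c₁ c₂ c₃ c₄ c₅ c₆ w₁ w₂ e →
               c₅ :* ((c₄ :* w₁ :- c₂ :* w₂) :* e) :+ c₆ :* ((c₁ :* w₂ :- c₃ :* w₁) :* e)
               := e :* ((c₁ :* c₆ :- c₂ :* c₅) :* w₂ :- (c₃ :* c₆ :- c₄ :* c₅) :* w₁))
               refl c₁ c₂ c₃ c₄ c₅ c₆ w₁ w₂ e ⟩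
        e * (D₁₆ * w₂ - D₃₆ * w₁) ≈⟨ *-congˡ compatible ⟩
        e * (D₁₂ * w₃)            ≈⟨ solve 3 (λ e D w → e :* (D :* w) := (D :* e) :* w) refl e D₁₂ w₃ ⟩
        (D₁₂ * e) * w₃            ≈⟨ D₁₂e*w≈w w₃ ⟩
        w₃                        ∎

    reduction-to-diagonal-form : ∀ {e s₁ s₂ s₃} → D₁₂ * e ≈ 1# →
      A * (s₁ * s₁) + B * (s₂ * s₂) ≈ C * (s₃ * s₃) + K →
      ∃₂ λ u v → c₁ * u + c₂ * v ≈ δ₁ * (s₁ * s₁) + λ₁ ×
                 c₃ * u + c₄ * v ≈ δ₂ * (s₂ * s₂) + λ₂ ×
                 c₅ * u + c₆ * v ≈ δ₃ * (s₃ * s₃) + λ₃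
    reduction-to-diagonal-form {e} {s₁} {s₂} {s₃} D₁₂e≈1 diagonal =
      cramer (δ₁ * S₁ + λ₁) (δ₂ * S₂ + λ₂) (δ₃ * S₃ + λ₃) D₁₂e≈1 (begin
        D₁₆ * (δ₂ * S₂ + λ₂) - D₃₆ * (δ₁ * S₁ + λ₁)
          ≈⟨ solve 8 (λ D₁₆ D₃₆ δ₁ δ₂ S₁ S₂ λ₁ λ₂ →
               D₁₆ :* (δ₂ :* S₂ :+ λ₂) :- D₃₆ :* (δ₁ :* S₁ :+ λ₁)
               := (:- D₃₆ :* δ₁ :* S₁ :+ D₁₆ :* δ₂ :* S₂) :+ (D₁₆ :* λ₂ :- D₃₆ :* λ₁))
               refl D₁₆ D₃₆ δ₁ δ₂ S₁ S₂ λ₁ λ₂ ⟩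
        (A * S₁ + B * S₂) + (D₁₆ * λ₂ - D₃₆ * λ₁)
          ≈⟨ +-congʳ diagonal ⟩
        (C * S₃ + K) + (D₁₆ * λ₂ - D₃₆ * λ₁)
          ≈⟨ solve 8 (λ D₁₂ D₁₆ D₃₆ δ₃ S₃ λ₁ λ₂ λ₃ →
               (D₁₂ :* δ₃ :* S₃ :+ (D₁₂ :* λ₃ :+ D₃₆ :* λ₁ :- D₁₆ :* λ₂)) :+ (D₁₆ :* λ₂ :- D₃₆ :* λ₁)
               := D₁₂ :* (δ₃ :* S₃ :+ λ₃))
               refl D₁₂ D₁₆ D₃₆ δ₃ S₃ λ₁ λ₂ λ₃ ⟩
        D₁₂ * (δ₃ * S₃ + λ₃) ∎)
      where
      S₁ = s₁ * s₁
      S₂ = s₂ * s₂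
      S₃ = s₃ * s₃

module FiniteField {c ℓ} (F : CommutativeRing c ℓ) (q : ℕ) (isFiniteField : IsFiniteField F q) where
  open CommutativeRing F
  open IsFiniteField isFiniteField
  open CommutativeRingLemmas F
    using (x+x≈[1+1]*x; -x≈0⇒x≈0; x≈0⇒y*[x*x]≈0; x*y≈1⇒x*[y*z]≈z; conic-parametrisation;
           module DiscreteField)
  open import Algebra.Properties.Ring ring
    using (-‿involutive; -‿injective; -0#≈0#; +-cancelˡ; +-inverseˡ-unique; x∙y⁻¹≈ε⇒x≈y; x≈y⇒x∙y⁻¹≈ε;
           //-rightDividesˡ)
  open IntegerCoefficientSolver F using (solve; _:+_; _:*_; _:=_)
  open import Relation.Binary.Reasoning.Setoid setoid

  idx : Carrier → Fin q
  idx x = proj₁ (enum-surjective x)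

  enum-idx : ∀ x → enum (idx x) ≈ x
  enum-idx x = proj₂ (enum-surjective x)

  idx-cong : ∀ {x y} → x ≈ y → idx x ≡ idx y
  idx-cong {x} {y} x≈y = enum-injective _ _ (trans (enum-idx x) (trans x≈y (sym (enum-idx y))))

  idx-injective : ∀ {x y} → idx x ≡ idx y → x ≈ y
  idx-injective {x} {y} eq = trans (sym (enum-idx x)) (trans (reflexive (≡.cong enum eq)) (enum-idx y))

  infix 4 _≟_
  _≟_ : Decidable _≈_
  x ≟ y = map′ idx-injective idx-cong (idx x Fin.≟ idx y)

  open DiscreteField 0≉1 inverse _≟_ public

  1≉0 : 1# ≉ 0#
  1≉0 1≈0 = 0≉1 (sym 1≈0)

  missing-element : ∀ {n} → n < q → (f : Fin n → Carrier) → ∃ λ x → ∀ k → x ≉ f k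
  missing-element {n} n<q f with any? (λ i → all? (λ k → ¬? (enum i ≟ f k)))
  ... | yes (i , enumᵢ-missing) = enum i , enumᵢ-missing
  ... | no  none-missing = ⊥-elim (<⇒notInjective n<q preimage-injective)
    where
    preimage : ∀ i → ∃ λ k → enum i ≈ f k
    preimage i with any? (λ k → enum i ≟ f k)
    ... | yes found = found
    ... | no  not-found = ⊥-elim (none-missing (i , λ k eq → not-found (k , eq)))
    preimage-injective : Injective _≡_ _≡_ (proj₁ ∘ preimage)
    preimage-injective {i} {j} eq = enum-injective i j
      (trans (proj₂ (preimage i)) (trans (reflexive (≡.cong f eq)) (sym (proj₂ (preimage j)))))

  pure-quadratic-roots : ∀ {B} K → B ≉ 0# → ∃ λ r → ∀ m → B * (m * m) ≈ K → m ≈ r ⊎ m ≈ - r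
  pure-quadratic-roots {B} K B≉0 with any? (λ i → B * (enum i * enum i) ≟ K)
  ... | yes (i , root) = enum i , λ m Bm²≈K →
    x*x≈y*y⇒y≈x⊎y≈-x (*-cancelˡ B≉0 (trans root (sym Bm²≈K)))
  ... | no  no-root = 0# , λ m Bm²≈K →
    ⊥-elim (no-root (idx m , trans (*-congˡ (*-cong (enum-idx m) (enum-idx m))) Bm²≈K))

  -- True for exactly one of x and - x when they differ.
  positive : Carrier → Bool
  positive x = does (idx x ≤? idx (- x))

  positive-0# : ∀ {x} → x ≈ 0# → positive x ≡ true
  positive-0# {x} x≈0 = dec-true (idx x ≤? idx (- x)) (≤-reflexive (idx-cong x≈-x))
    where
    x≈-x : x ≈ - x
    x≈-x = trans x≈0 (trans (sym -0#≈0#) (-‿cong (sym x≈0)))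

  positive-distinguishes-± : ∀ {x y} → positive x ≡ positive y → y ≈ x ⊎ y ≈ - x → x ≈ y
  positive-distinguishes-± same (inj₁ y≈x) = sym y≈x
  positive-distinguishes-± {x} {y} same (inj₂ y≈-x) =
    idx-injective (≡.trans (≤?-symmetric⇒≡ (idx x) (idx (- x)) same′) (idx-cong (sym y≈-x)))
    where
    same′ : does (idx x ≤? idx (- x)) ≡ does (idx (- x) ≤? idx x)
    same′ = ≡.trans same (≡.cong₂ (λ i j → does (i ≤? j)) (idx-cong y≈-x)
                                   (idx-cong (trans (-‿cong y≈-x) (-‿involutive x))))

  InjectiveUpToSign : (Carrier → Carrier) → Set (c ⊔ ℓ)
  InjectiveUpToSign f = ∀ {x y} → f x ≈ f y → y ≈ x ⊎ y ≈ - x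

  -- If the ranges were disjoint, Ψ would be an injective self-map of a finite set missing a point.
  ranges-meet : ∀ f g → InjectiveUpToSign f → InjectiveUpToSign g → ∃₂ λ x y → f x ≈ g y
  ranges-meet f g f-injective g-injective with any? (λ i → any? (λ j → f (enum i) ≟ g (enum j)))
  ... | yes (i , j , fx≈gy) = enum i , enum j , fx≈gy
  ... | no  disjoint =
    ⊥-elim (missing-point⇒¬injective (Fin[2*n]↔Bool×Fin q) Ψ (true , idx (g (enum o)))
                                     Ψ-misses Ψ-injective)
    where
    Ψ : Bool × Fin q → Bool × Fin q
    Ψ (true  , i) = positive (enum i) , idx (f (enum i))
    Ψ (false , j) = not (positive (enum j)) , idx (g (enum j))

    Ψ-injective : Injective _≡_ _≡_ Ψ
    Ψ-injective {true , i} {true , i′} eq with ×-≡,≡←≡ eq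
    ... | same-sign , same-value = ≡.cong (true ,_) (enum-injective i i′
      (positive-distinguishes-± same-sign (f-injective (idx-injective same-value))))
    Ψ-injective {false , j} {false , j′} eq with ×-≡,≡←≡ eq
    ... | same-sign , same-value = ≡.cong (false ,_) (enum-injective j j′
      (positive-distinguishes-± (not-injective same-sign) (g-injective (idx-injective same-value))))
    Ψ-injective {true , i} {false , j} eq =
      ⊥-elim (disjoint (i , j , idx-injective (proj₂ (×-≡,≡←≡ eq))))
    Ψ-injective {false , j} {true , i} eq =
      ⊥-elim (disjoint (i , j , idx-injective (≡.sym (proj₂ (×-≡,≡←≡ eq)))))

    o : Fin q
    o = idx 0#

    Ψ-misses : ∀ a → Ψ a ≢ (true , idx (g (enum o)))
    Ψ-misses (true , i) eq = disjoint (i , o , idx-injective (proj₂ (×-≡,≡←≡ eq)))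
    Ψ-misses (false , j) eq with ×-≡,≡←≡ eq
    ... | not-positive , same-value =
      not-true (≡.trans (≡.cong not (≡.sym (positive-0# y≈0))) not-positive)
      where
      y≈0 : enum j ≈ 0#
      y≈0 = [ (λ o≈y → trans (sym o≈y) (enum-idx 0#))
            , (λ o≈-y → -x≈0⇒x≈0 (trans (sym o≈-y) (enum-idx 0#)))
            ]′ (g-injective (idx-injective same-value))
      not-true : false ≢ true
      not-true ()

  diagonal-form-surjective : ∀ {A B} → A ≉ 0# → B ≉ 0# → ∀ t → ∃₂ λ x y → A * (x * x) + B * (y * y) ≈ t
  diagonal-form-surjective {A} {B} A≉0 B≉0 t =
    let (x , y , Ax²≈t-By²) = ranges-meet (λ x → A * (x * x)) (λ y → t - B * (y * y))
          (λ eq → x*x≈y*y⇒y≈x⊎y≈-x (*-cancelˡ A≉0 eq))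
          (λ eq → x*x≈y*y⇒y≈x⊎y≈-x (*-cancelˡ B≉0 (-‿injective (+-cancelˡ t _ _ eq))))
    in x , y , trans (+-congʳ Ax²≈t-By²) (//-rightDividesˡ (B * (y * y)) t)

  char-2-square-root : 1# + 1# ≈ 0# → ∀ w → ∃ λ s → s * s ≈ w
  char-2-square-root 1+1≈0 w =
    let (x , y , x²+y²≈w) = diagonal-form-surjective 1≉0 1≉0 w
        xy+xy≈0 : x * y + x * y ≈ 0#
        xy+xy≈0 = trans (x+x≈[1+1]*x (x * y)) (trans (*-congʳ 1+1≈0) (zeroˡ _))
    in x + y , (begin
      (x + y) * (x + y)
        ≈⟨ solve 2 (λ x y → (x :+ y) :* (x :+ y) := (x :* x :+ y :* y) :+ (x :* y :+ x :* y)) refl x y ⟩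
      (x * x + y * y) + (x * y + x * y)
        ≈⟨ +-cong (sym (+-cong (*-identityˡ _) (*-identityˡ _))) xy+xy≈0 ⟩
      (1# * (x * x) + 1# * (y * y)) + 0#
        ≈⟨ +-identityʳ _ ⟩
      1# * (x * x) + 1# * (y * y)
        ≈⟨ x²+y²≈w ⟩
      w ∎)

  NonzeroRepresentation : Carrier → Carrier → Carrier → Set (c ⊔ ℓ)
  NonzeroRepresentation A B t = ∃₂ λ x y → x ≉ 0# × y ≉ 0# × A * (x * x) + B * (y * y) ≈ t

  representation-swap : ∀ {A B t} → NonzeroRepresentation A B t → NonzeroRepresentation B A t
  representation-swap (x , y , x≉0 , y≉0 , eq) = y , x , y≉0 , x≉0 , trans (+-comm _ _) eq

  module _ (5<q : 5 < q) where

    nonzero-non-root : ∀ {B} K₁ K₂ → B ≉ 0# →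
                       ∃ λ m → m ≉ 0# × B * (m * m) + K₁ ≉ 0# × B * (m * m) + K₂ ≉ 0#
    nonzero-non-root {B} K₁ K₂ B≉0
      with pure-quadratic-roots (- K₁) B≉0 | pure-quadratic-roots (- K₂) B≉0
    ... | r₁ , roots₁ | r₂ , roots₂ with missing-element 5<q (lookup (0# ∷ r₁ ∷ - r₁ ∷ r₂ ∷ - r₂ ∷ []))
    ... | m , m-missing = m , m-missing 0F ,
      [ m-missing 1F , m-missing 2F ]′ ∘ roots₁ m ∘ +-inverseˡ-unique _ _ ,
      [ m-missing 3F , m-missing 4F ]′ ∘ roots₂ m ∘ +-inverseˡ-unique _ _

    char-2-representation : ∀ {A B t} → 1# + 1# ≈ 0# → A ≉ 0# → B ≉ 0# → NonzeroRepresentation A B t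
    char-2-representation {A} {B} {t} 1+1≈0 A≉0 B≉0 =
      let (y , y≉0 , By²-t≉0 , _) = nonzero-non-root (- t) (- t) B≉0
          (a , Aa≈1) = inverse A A≉0
          (s , s²≈a[t-By²]) = char-2-square-root 1+1≈0 (a * (t - B * (y * y)))
          As²≈t-By² : A * (s * s) ≈ t - B * (y * y)
          As²≈t-By² = trans (*-congˡ s²≈a[t-By²]) (x*y≈1⇒x*[y*z]≈z Aa≈1 _)
          s≉0 : s ≉ 0#
          s≉0 s≈0 = By²-t≉0 (x≈y⇒x∙y⁻¹≈ε (sym (x∙y⁻¹≈ε⇒x≈y _ _
                      (trans (sym As²≈t-By²) (x≈0⇒y*[x*x]≈0 A s≈0)))))
      in s , y , s≉0 , y≉0 , trans (+-congʳ As²≈t-By²) (//-rightDividesˡ (B * (y * y)) t)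

    axis-point⇒nonzero-representation : ∀ {A B t x₀} → 1# + 1# ≉ 0# → A ≉ 0# → B ≉ 0# → t ≉ 0# →
                                        A * (x₀ * x₀) ≈ t → NonzeroRepresentation A B t
    axis-point⇒nonzero-representation {A} {B} {t} {x₀} 1+1≉0 A≉0 B≉0 t≉0 Ax₀²≈t =
      let (m , m≉0 , Bm²+A≉0 , Bm²-A≉0) = nonzero-non-root A (- A) B≉0
          (d , Dd≈1) = inverse (B * (m * m) + A) Bm²+A≉0
          x₀≉0 : x₀ ≉ 0#
          x₀≉0 x₀≈0 = t≉0 (trans (sym Ax₀²≈t) (x≈0⇒y*[x*x]≈0 A x₀≈0))
          d≉0 = x*y≈1⇒y≉0 Dd≈1
      in x₀ * (B * (m * m) - A) * d , (x₀ + x₀) * A * m * d ,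
         *-≉0 (*-≉0 x₀≉0 Bm²-A≉0) d≉0 ,
         *-≉0 (*-≉0 (*-≉0 (x+x≉0 1+1≉0 x₀≉0) A≉0) m≉0) d≉0 ,
         trans (conic-parametrisation A B x₀ m d Dd≈1) Ax₀²≈t

    solution⇒nonzero-representation : ∀ {A B t x y} → 1# + 1# ≉ 0# → A ≉ 0# → B ≉ 0# → t ≉ 0# →
                                      A * (x * x) + B * (y * y) ≈ t → NonzeroRepresentation A B t
    solution⇒nonzero-representation {A} {B} {x = x} {y} 1+1≉0 A≉0 B≉0 t≉0 solution with x ≟ 0# | y ≟ 0#
    ... | no x≉0  | no y≉0 = x , y , x≉0 , y≉0 , solution
    ... | _       | yes y≈0 = axis-point⇒nonzero-representation 1+1≉0 A≉0 B≉0 t≉0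
      (trans (sym (trans (+-congˡ (x≈0⇒y*[x*x]≈0 B y≈0)) (+-identityʳ _))) solution)
    ... | yes x≈0 | no _ = representation-swap (axis-point⇒nonzero-representation 1+1≉0 B≉0 A≉0 t≉0
      (trans (sym (trans (+-congʳ (x≈0⇒y*[x*x]≈0 A x≈0)) (+-identityˡ _))) solution))

    nonzero-representation : ∀ {A B t} → A ≉ 0# → B ≉ 0# → t ≉ 0# → NonzeroRepresentation A B t
    nonzero-representation {t = t} A≉0 B≉0 t≉0 with 1# + 1# ≟ 0#
    ... | yes 1+1≈0 = char-2-representation 1+1≈0 A≉0 B≉0
    ... | no  1+1≉0 = solution⇒nonzero-representation 1+1≉0 A≉0 B≉0 t≉0
                        (proj₂ (proj₂ (diagonal-form-surjective A≉0 B≉0 t)))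

lemma2p7 : ∀ {c ℓ} (F : CommutativeRing c ℓ) (q : ℕ) → IsFiniteField F q → q % 2 ≡ 1 → 5 < q →
    let open CommutativeRing F in
    ∀ (c₁ c₂ c₃ c₄ c₅ c₆ : Carrier) →
      ¬ (c₁ * c₄ - c₂ * c₃ ≈ 0#) → ¬ (c₁ * c₆ - c₂ * c₅ ≈ 0#) → ¬ (c₃ * c₆ - c₄ * c₅ ≈ 0#) →
      ∀ (δ₁ δ₂ δ₃ : Carrier) → ¬ (δ₁ ≈ 0#) → ¬ (δ₂ ≈ 0#) → ¬ (δ₃ ≈ 0#) →
      ∀ (λ₁ λ₂ λ₃ : Carrier) →
      Σ Carrier λ u → Σ Carrier λ v → Σ Carrier λ s₁ → Σ Carrier λ s₂ → Σ Carrier λ s₃ →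
        ¬ (s₁ ≈ 0#) × ¬ (s₂ ≈ 0#) × ¬ (s₃ ≈ 0#) ×
        (c₁ * u + c₂ * v ≈ δ₁ * (s₁ * s₁) + λ₁) ×
        (c₃ * u + c₄ * v ≈ δ₂ * (s₂ * s₂) + λ₂) ×
        (c₅ * u + c₆ * v ≈ δ₃ * (s₃ * s₃) + λ₃)
lemma2p7 F q isFiniteField _ 5<q c₁ c₂ c₃ c₄ c₅ c₆ D₁₂≉0 D₁₆≉0 D₃₆≉0 δ₁ δ₂ δ₃ δ₁≉0 δ₂≉0 δ₃≉0 λ₁ λ₂ λ₃ =
  let open FiniteField F q isFiniteField
      open CommutativeRingLemmas.Elimination F c₁ c₂ c₃ c₄ c₅ c₆ δ₁ δ₂ δ₃ λ₁ λ₂ λ₃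
      (s₃ , s₃≉0 , Cs₃²+K≉0 , _) = nonzero-non-root 5<q K K (*-≉0 D₁₂≉0 δ₃≉0)
      (s₁ , s₂ , s₁≉0 , s₂≉0 , diagonal) =
        nonzero-representation 5<q (*-≉0 (-‿≉0 D₃₆≉0) δ₁≉0) (*-≉0 D₁₆≉0 δ₂≉0) Cs₃²+K≉0
      (e , D₁₂e≈1) = IsFiniteField.inverse isFiniteField D₁₂ D₁₂≉0
      (u , v , eq₁ , eq₂ , eq₃) = reduction-to-diagonal-form D₁₂e≈1 diagonal
  in u , v , s₁ , s₂ , s₃ , s₁≉0 , s₂≉0 , s₃≉0 , eq₁ , eq₂ , eq₃
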